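{- If $m,n\ge 2$, then $\mu(K_m\,\square\, K_n)=z(m,n;2,2)$.
   Context: $K_k$ is the complete graph on $k$ vertices; $G\,\square\, H$ is the Cartesian product (vertex set $V(G)\times V(H)$, $(g,h)\sim(g',h')$ iff ($gg'\in E(G)$ and $h=h'$) or ($g=g'$ and $hh'\in E(H)$)). For a connected graph $G$ and $X\subseteq V(G)$, two vertices $x,y\in X$ are $X$-visible if there is a shortest $x,y$-path $P$ in $G$ with $V(P)\cap X=\{x,y\}$; $X$ is a mutual-visibility set if every two vertices of $X$ are $X$-visible; $\mu(G)$ is the largest size of a mutual-visibility set. For positive integers $m,n,s,t$, $z(m,n;s,t)$ (Zarankiewicz number) is the maximum number of $1$s in an $m\times n$ binary matrix that contains no $s\times t$ submatrix (choice of $s$ rows and $t$ columns) consisting entirely of $1$s. -}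

module Defs where

open import Data.Nat using (ℕ; zero; suc; _≤_)
open import Data.Bool using (Bool; true; false; if_then_else_)
open import Data.Fin using (Fin)
open import Data.List using (List; []; _∷_; length; head; last; map; allFin)
open import Data.Nat.ListAction using (sum)
open import Data.Empty using (⊥)
open import Data.List.Membership.Propositional using (_∈_)
open import Data.List.Relation.Unary.Linked using (Linked)
open import Data.List.Relation.Unary.Unique.Propositional using (Unique)
open import Data.List.Relation.Unary.All using (All)
open import Data.Maybe using (just)
open import Data.Product using (Σ; _×_; _,_)
open import Data.Sum using (_⊎_)
open import Relation.Binary.PropositionalEquality using (_≡_; _≢_)

record Graph : Set₁ where
  field
    V   : Set
    Adj : V → V → Set
open Graph public

K : ℕ → Graph
K k = record { V = Fin k ; Adj = λ a b → a ≢ b }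

_□_ : Graph → Graph → Graph
G □ H = record
  { V   = V G × V H
  ; Adj = λ { (g , h) (g' , h') →
              (Adj G g g' × h ≡ h') ⊎ (g ≡ g' × Adj H h h') } }

-- p is an x,y-walk in G (listed by its vertices x = v₀, …, vₖ = y);
-- its length (number of edges) is length p ∸ 1.
IsWalk : (G : Graph) → V G → V G → List (V G) → Set
IsWalk G x y p = Linked (Adj G) p × head p ≡ just x × last p ≡ just y

-- p is a shortest x,y-path: an x,y-walk of minimum length
-- (a minimum-length walk is automatically a path).
IsShortestPath : (G : Graph) → V G → V G → List (V G) → Set
IsShortestPath G x y p =
  IsWalk G x y p × (∀ q → IsWalk G x y q → length p ≤ length q)

Visible : (G : Graph) → List (V G) → V G → V G → Set
Visible G X x y =
  Σ (List (V G)) λ p → IsShortestPath G x y p ×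
    (∀ v → v ∈ p → v ∈ X → v ≡ x ⊎ v ≡ y)

IsMutualVisibilitySet : (G : Graph) → List (V G) → Set
IsMutualVisibilitySet G X =
  Unique X × (∀ x y → x ∈ X → y ∈ X → Visible G X x y)

IsMu : Graph → ℕ → Set
IsMu G k =
  (Σ (List (V G)) λ X → IsMutualVisibilitySet G X × length X ≡ k) ×
  (∀ X → IsMutualVisibilitySet G X → length X ≤ k)

Matrix : ℕ → ℕ → Set
Matrix m n = Fin m → Fin n → Bool

ones : ∀ {m n} → Matrix m n → ℕ
ones {m} {n} M =
  sum (map (λ i → sum (map (λ j → if M i j then 1 else 0) (allFin n))) (allFin m))

HasAllOnesSub : ∀ {m n} → Matrix m n → ℕ → ℕ → Set
HasAllOnesSub {m} {n} M s t =
  Σ (List (Fin m)) λ R → Σ (List (Fin n)) λ C →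
    Unique R × length R ≡ s × Unique C × length C ≡ t ×
    All (λ r → All (λ c → M r c ≡ true) C) R

IsZarankiewicz : ℕ → ℕ → ℕ → ℕ → ℕ → Set
IsZarankiewicz m n s t k =
  (Σ (Matrix m n) λ M → (HasAllOnesSub M s t → ⊥) × ones M ≡ k) ×
  (∀ (M : Matrix m n) → (HasAllOnesSub M s t → ⊥) → ones M ≤ k)

-- In K m □ K n two vertices in a common row or column are adjacent, while
-- (a , b) and (c , d) with a ≢ c and b ≢ d are at distance two and their only
-- common neighbours are the opposite corners (a , d) and (c , b).  Hence a set
-- X of vertices is a mutual-visibility set exactly when no rectangle has all
-- four corners in X, i.e. when the 0/1 matrix of X has no 2 × 2 all-ones
-- submatrix.  Since |X| is the number of ones of that matrix, the two maxima
-- coincide.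

module Submission where

open import Defs
open import Data.Bool using (Bool; true; false; if_then_else_)
open import Data.Bool.Properties using (T-≡) renaming (_≟_ to _≟ᵇ_)
open import Data.Empty using (⊥; ⊥-elim)
open import Data.Fin using (Fin; zero; suc)
open import Data.Fin.Properties using (_≟_; all?)
open import Data.List using (List; []; _∷_; _++_; length; map; concat; allFin; filter; filterᵇ; cartesianProduct)
open import Data.List.Extrema.Nat using (argmax; argmax-all; f[xs]≤f[argmax])
open import Data.List.Membership.Propositional using (_∈_; _∉_)
open import Data.List.Membership.Propositional.Properties using (∈-map⁺; ∈-concat⁺′; ∈-filter⁺; ∈-filter⁻; ∈-cartesianProduct⁺; ∈-allFin)
open import Data.List.Membership.Propositional.Properties.WithK using (unique∧set⇒bag)
import Data.List.Membership.DecPropositional as DecMembership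
open import Data.List.Properties using (map-++; map-∘; map-cong)
open import Data.List.Relation.Binary.BagAndSetEquality using (∼bag⇒↭)
open import Data.List.Relation.Binary.Permutation.Propositional.Properties using (↭-length)
open import Data.List.Relation.Unary.All using (All; []; _∷_; lookup)
open import Data.List.Relation.Unary.All.Properties using (all-filter)
open import Data.List.Relation.Unary.AllPairs using ([]; _∷_)
open import Data.List.Relation.Unary.Any using (here; there)
open import Data.List.Relation.Unary.Linked using ([-]; _∷_)
open import Data.List.Relation.Unary.Unique.Propositional using (Unique)
import Data.List.Relation.Unary.Unique.Propositional.Properties as Uniqueₚ
open import Data.Nat using (ℕ; zero; suc; _+_; _≤_; z≤n; s≤s)
open import Data.Nat.ListAction using (sum)
open import Data.Nat.ListAction.Properties using (sum-++)
open import Data.Nat.Properties using (≤-trans; ≤-reflexive)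
open import Data.Product using (Σ; _×_; _,_; proj₁; proj₂; uncurry)
open import Data.Product.Properties using (≡-dec)
open import Data.Sum using (_⊎_; inj₁; inj₂; [_,_])
import Data.Vec.Functional as Vector
open import Function using (_∘_)
open import Function.Bundles using (Equivalence; mk⇔)
open import Relation.Nullary using (yes; no; ¬_; does)
open import Relation.Nullary.Decidable using (¬?; _→-dec_; T?; dec-true)
open import Relation.Unary using (Decidable)
open import Relation.Binary.PropositionalEquality using (_≡_; _≢_; refl; sym; trans; cong; cong₂; subst; module ≡-Reasoning)

module _ (G : Graph) where

  walk-nonempty : ∀ {x y} → ¬ IsWalk G x y []
  walk-nonempty (_ , () , _)

  1≤length-walk : ∀ {x y} p → IsWalk G x y p → 1 ≤ length p
  1≤length-walk []      w = ⊥-elim (walk-nonempty w)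
  1≤length-walk (_ ∷ _) _ = s≤s z≤n

  2≤length-walk : ∀ {x y} → x ≢ y → ∀ p → IsWalk G x y p → 2 ≤ length p
  2≤length-walk _   []          w                 = ⊥-elim (walk-nonempty w)
  2≤length-walk x≢y (_ ∷ [])    (_ , refl , refl) = ⊥-elim (x≢y refl)
  2≤length-walk _   (_ ∷ _ ∷ _) _                 = s≤s (s≤s z≤n)

  3≤length-walk : ∀ {x y} → x ≢ y → ¬ Adj G x y → ∀ p → IsWalk G x y p → 3 ≤ length p
  3≤length-walk _   _   []              w                        = ⊥-elim (walk-nonempty w)
  3≤length-walk x≢y _   (_ ∷ [])        (_ , refl , refl)        = ⊥-elim (x≢y refl)
  3≤length-walk _   ¬xy (_ ∷ _ ∷ [])    (xy ∷ [-] , refl , refl) = ⊥-elim (¬xy xy)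
  3≤length-walk _   _   (_ ∷ _ ∷ _ ∷ _) _                        = s≤s (s≤s (s≤s z≤n))

  visible-refl : ∀ X x → Visible G X x x
  visible-refl X x =
    x ∷ [] , (([-] , refl , refl) , 1≤length-walk) , λ { _ (here refl) _ → inj₁ refl }

  adjacent⇒visible : ∀ X {x y} → x ≢ y → Adj G x y → Visible G X x y
  adjacent⇒visible X {x} {y} x≢y xy =
    x ∷ y ∷ [] , ((xy ∷ [-] , refl , refl) , 2≤length-walk x≢y) ,
    λ { _ (here refl) _ → inj₁ refl ; _ (there (here refl)) _ → inj₂ refl }

  detour⇒visible : ∀ X {x y v} → x ≢ y → ¬ Adj G x y →
                   Adj G x v → Adj G v y → v ∉ X → Visible G X x y
  detour⇒visible X {x} {y} x≢y ¬xy xv vy v∉X =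
    x ∷ _ ∷ y ∷ [] , ((xv ∷ vy ∷ [-] , refl , refl) , 3≤length-walk x≢y ¬xy) ,
    λ { _ (here refl) _                   → inj₁ refl
      ; _ (there (here refl)) v∈X         → ⊥-elim (v∉X v∈X)
      ; _ (there (there (here refl))) _   → inj₂ refl }

  -- At distance two, a shortest path has exactly one interior vertex, which
  -- visibility forces out of X.
  visible⇒detour∉ : ∀ {X x y w} → x ≢ y → ¬ Adj G x y → Adj G x w → Adj G w y →
                    Visible G X x y → Σ (V G) λ v → Adj G x v × Adj G v y × v ∉ X
  visible⇒detour∉ {X} {x} {y} x≢y ¬xy xw wy (p , (walk , shortest) , avoids) =
    interior p walk (shortest _ (xw ∷ wy ∷ [-] , refl , refl)) avoids
    where
    interior : ∀ p → IsWalk G x y p → length p ≤ 3 →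
               (∀ v → v ∈ p → v ∈ X → v ≡ x ⊎ v ≡ y) →
               Σ (V G) λ v → Adj G x v × Adj G v y × v ∉ X
    interior p walk _ _ with 3≤length-walk x≢y ¬xy p walk
    interior (_ ∷ []) _ _ _ | s≤s ()
    interior (_ ∷ _ ∷ []) _ _ _ | s≤s (s≤s ())
    interior (_ ∷ _ ∷ _ ∷ _ ∷ _) _ (s≤s (s≤s (s≤s ()))) _ | _
    interior (_ ∷ v ∷ _ ∷ []) (xv ∷ vy ∷ [-] , refl , refl) _ avoids | _ =
      v , xv , vy ,
      λ v∈X → [ (λ v≡x → ¬xy (subst (λ u → Adj G u y) v≡x vy))
              , (λ v≡y → ¬xy (subst (Adj G x) v≡y xv)) ]
              (avoids v (there (here refl)) v∈X)

module _ {m n : ℕ} where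

  open DecMembership (≡-dec (_≟_ {m}) (_≟_ {n})) using (_∈?_)

  rook-¬Adj : ∀ {a c : Fin m} {b d : Fin n} → a ≢ c → b ≢ d →
              ¬ Adj (K m □ K n) (a , b) (c , d)
  rook-¬Adj _   b≢d (inj₁ (_ , b≡d)) = b≢d b≡d
  rook-¬Adj a≢c _   (inj₂ (a≡c , _)) = a≢c a≡c

  rook-common-neighbour : ∀ {a c : Fin m} {b d : Fin n} {v} → a ≢ c → b ≢ d →
                          Adj (K m □ K n) (a , b) v → Adj (K m □ K n) v (c , d) →
                          v ≡ (a , d) ⊎ v ≡ (c , b)
  rook-common-neighbour _   b≢d (inj₁ (_ , refl)) (inj₁ (_ , refl)) = ⊥-elim (b≢d refl)
  rook-common-neighbour _   _   (inj₁ (_ , refl)) (inj₂ (refl , _)) = inj₂ refl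
  rook-common-neighbour _   _   (inj₂ (refl , _)) (inj₁ (_ , refl)) = inj₁ refl
  rook-common-neighbour a≢c _   (inj₂ (refl , _)) (inj₂ (refl , _)) = ⊥-elim (a≢c refl)

  corner∉⇒visible : ∀ X a b c d → (a ≢ c → b ≢ d → (a , d) ∈ X → (c , b) ∈ X → ⊥) →
                    Visible (K m □ K n) X (a , b) (c , d)
  corner∉⇒visible X a b c d corner∉ with a ≟ c | b ≟ d
  ... | yes refl | yes refl = visible-refl (K m □ K n) X (a , b)
  ... | yes refl | no b≢d   =
    adjacent⇒visible (K m □ K n) X (b≢d ∘ cong proj₂) (inj₂ (refl , b≢d))
  ... | no a≢c   | yes refl =
    adjacent⇒visible (K m □ K n) X (a≢c ∘ cong proj₁) (inj₁ (a≢c , refl))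
  ... | no a≢c   | no b≢d   with (a , d) ∈? X | (c , b) ∈? X
  ...   | no ad∉X  | _        =
    detour⇒visible (K m □ K n) X (a≢c ∘ cong proj₁) (rook-¬Adj a≢c b≢d)
      (inj₂ (refl , b≢d)) (inj₁ (a≢c , refl)) ad∉X
  ...   | yes _    | no cb∉X  =
    detour⇒visible (K m □ K n) X (a≢c ∘ cong proj₁) (rook-¬Adj a≢c b≢d)
      (inj₁ (a≢c , refl)) (inj₂ (refl , b≢d)) cb∉X
  ...   | yes ad∈X | yes cb∈X = ⊥-elim (corner∉ a≢c b≢d ad∈X cb∈X)

  visible⇒corner∉ : ∀ {X a b c d} → Visible (K m □ K n) X (a , b) (c , d) →
                    a ≢ c → b ≢ d → (a , d) ∈ X → (c , b) ∈ X → ⊥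
  visible⇒corner∉ vis a≢c b≢d ad∈X cb∈X
    with visible⇒detour∉ (K m □ K n) (a≢c ∘ cong proj₁) (rook-¬Adj a≢c b≢d)
           (inj₂ (refl , b≢d)) (inj₁ (a≢c , refl)) vis
  ... | v , av , vc , v∉X with rook-common-neighbour a≢c b≢d av vc
  ...   | inj₁ refl = v∉X ad∈X
  ...   | inj₂ refl = v∉X cb∈X

RectangleFree : ∀ {m n} → Matrix m n → Set
RectangleFree {m} {n} M = ∀ (r r' : Fin m) (c c' : Fin n) → r ≢ r' → c ≢ c' →
  M r c ≡ true → M r c' ≡ true → M r' c ≡ true → M r' c' ≡ true → ⊥

rectangleFree? : ∀ {m n} → Decidable (RectangleFree {m} {n})
rectangleFree? M = all? λ r → all? λ r' → all? λ c → all? λ c' →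
  ¬? (r ≟ r') →-dec ¬? (c ≟ c') →-dec (M r c ≟ᵇ true) →-dec (M r c' ≟ᵇ true) →-dec
  (M r' c ≟ᵇ true) →-dec (M r' c' ≟ᵇ true) →-dec no (λ ())

rectangleFree-cong : ∀ {m n} {M M' : Matrix m n} → (∀ i j → M i j ≡ M' i j) →
                     RectangleFree M → RectangleFree M'
rectangleFree-cong M≗M' rf r r' c c' r≢r' c≢c' e₁ e₂ e₃ e₄ =
  rf r r' c c' r≢r' c≢c' (trans (M≗M' r c) e₁) (trans (M≗M' r c') e₂)
     (trans (M≗M' r' c) e₃) (trans (M≗M' r' c') e₄)

¬HasAllOnesSub⇒rectangleFree : ∀ {m n} {M : Matrix m n} → ¬ HasAllOnesSub M 2 2 → RectangleFree M
¬HasAllOnesSub⇒rectangleFree noSub r r' c c' r≢r' c≢c' e₁ e₂ e₃ e₄ =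
  noSub (r ∷ r' ∷ [] , c ∷ c' ∷ [] , ((r≢r' ∷ []) ∷ [] ∷ []) , refl , ((c≢c' ∷ []) ∷ [] ∷ []) , refl ,
         ((e₁ ∷ e₂ ∷ []) ∷ (e₃ ∷ e₄ ∷ []) ∷ []))

rectangleFree⇒¬HasAllOnesSub : ∀ {m n} {M : Matrix m n} → RectangleFree M → ¬ HasAllOnesSub M 2 2
rectangleFree⇒¬HasAllOnesSub rf
  (r ∷ r' ∷ [] , c ∷ c' ∷ [] , ((r≢r' ∷ []) ∷ _) , refl , ((c≢c' ∷ []) ∷ _) , refl ,
   ((e₁ ∷ e₂ ∷ []) ∷ (e₃ ∷ e₄ ∷ []) ∷ [])) = rf r r' c c' r≢r' c≢c' e₁ e₂ e₃ e₄

ones-cong : ∀ {m n} {M M' : Matrix m n} → (∀ i j → M i j ≡ M' i j) → ones M ≡ ones M'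
ones-cong {m} {n} M≗M' = cong sum (map-cong
  (λ i → cong sum (map-cong (λ j → cong (if_then 1 else 0) (M≗M' i j)) (allFin n)))
  (allFin m))

length-filterᵇ : ∀ {A : Set} (p : A → Bool) xs →
                 length (filterᵇ p xs) ≡ sum (map (λ x → if p x then 1 else 0) xs)
length-filterᵇ p []       = refl
length-filterᵇ p (x ∷ xs) with p x
... | true  = cong suc (length-filterᵇ p xs)
... | false = length-filterᵇ p xs

sum-cartesianProduct : ∀ {A B : Set} (f : A → B → ℕ) xs ys →
  sum (map (uncurry f) (cartesianProduct xs ys)) ≡ sum (map (λ x → sum (map (f x) ys)) xs)
sum-cartesianProduct f []       ys = refl
sum-cartesianProduct f (x ∷ xs) ys = begin
  sum (map (uncurry f) (map (x ,_) ys ++ cartesianProduct xs ys))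
    ≡⟨ cong sum (map-++ (uncurry f) (map (x ,_) ys) _) ⟩
  sum (map (uncurry f) (map (x ,_) ys) ++ map (uncurry f) (cartesianProduct xs ys))
    ≡⟨ sum-++ (map (uncurry f) (map (x ,_) ys)) _ ⟩
  sum (map (uncurry f) (map (x ,_) ys)) + sum (map (uncurry f) (cartesianProduct xs ys))
    ≡⟨ cong₂ _+_ (cong sum (sym (map-∘ ys))) (sum-cartesianProduct f xs ys) ⟩
  sum (map (f x) ys) + sum (map (λ x → sum (map (f x) ys)) xs) ∎
  where open ≡-Reasoning

-- Vertex sets of K m □ K n as 0/1 matrices

module _ {m n : ℕ} where

  open DecMembership (≡-dec (_≟_ {m}) (_≟_ {n})) using (_∈?_)

  cells : List (Fin m × Fin n)
  cells = cartesianProduct (allFin m) (allFin n)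

  support : Matrix m n → List (Fin m × Fin n)
  support M = filterᵇ (uncurry M) cells

  indicator : List (Fin m × Fin n) → Matrix m n
  indicator X i j = does ((i , j) ∈? X)

  support-unique : ∀ M → Unique (support M)
  support-unique M = Uniqueₚ.filter⁺ (T? ∘ uncurry M)
    (Uniqueₚ.cartesianProduct⁺ (Uniqueₚ.allFin⁺ m) (Uniqueₚ.allFin⁺ n))

  ∈-support⁺ : ∀ {M i j} → M i j ≡ true → (i , j) ∈ support M
  ∈-support⁺ {M} {i} {j} e = ∈-filter⁺ (T? ∘ uncurry M)
    (∈-cartesianProduct⁺ (∈-allFin i) (∈-allFin j)) (Equivalence.from T-≡ e)

  ∈-support⁻ : ∀ {M i j} → (i , j) ∈ support M → M i j ≡ true
  ∈-support⁻ {M} ij∈ = Equivalence.to T-≡ (proj₂ (∈-filter⁻ (T? ∘ uncurry M) {xs = cells} ij∈))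

  length-support : ∀ M → length (support M) ≡ ones M
  length-support M = trans (length-filterᵇ (uncurry M) cells)
    (sum-cartesianProduct (λ i j → if M i j then 1 else 0) (allFin m) (allFin n))

  ∈⇒indicator : ∀ {X i j} → (i , j) ∈ X → indicator X i j ≡ true
  ∈⇒indicator {X} {i} {j} = dec-true ((i , j) ∈? X)

  indicator⇒∈ : ∀ {X i j} → indicator X i j ≡ true → (i , j) ∈ X
  indicator⇒∈ {X} {i} {j} e with (i , j) ∈? X
  ... | yes ij∈X = ij∈X
  indicator⇒∈ () | no _

  length≡ones-indicator : ∀ {X} → Unique X → length X ≡ ones (indicator X)
  length≡ones-indicator {X} X! = trans
    (↭-length (∼bag⇒↭ (unique∧set⇒bag X! (support-unique (indicator X))
      (mk⇔ (∈-support⁺ ∘ ∈⇒indicator) (indicator⇒∈ ∘ ∈-support⁻)))))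
    (length-support (indicator X))

  support-mutualVisibility : ∀ {M} → RectangleFree M → IsMutualVisibilitySet (K m □ K n) (support M)
  support-mutualVisibility {M} rf = support-unique M , λ where
    (a , b) (c , d) ab∈ cd∈ → corner∉⇒visible (support M) a b c d λ a≢c b≢d ad∈ cb∈ →
      rf a c b d a≢c b≢d (∈-support⁻ ab∈) (∈-support⁻ ad∈) (∈-support⁻ cb∈) (∈-support⁻ cd∈)

  mutualVisibility⇒indicator-rectangleFree : ∀ {X} → IsMutualVisibilitySet (K m □ K n) X →
                                             RectangleFree (indicator X)
  mutualVisibility⇒indicator-rectangleFree (_ , visible) r r' c c' r≢r' c≢c' e₁ e₂ e₃ e₄ =
    visible⇒corner∉ (visible (r , c) (r' , c') (indicator⇒∈ e₁) (indicator⇒∈ e₄))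
      r≢r' c≢c' (indicator⇒∈ e₂) (indicator⇒∈ e₃)

isZarankiewicz⇒isMu : ∀ {m n k} → IsZarankiewicz m n 2 2 k → IsMu (K m □ K n) k
isZarankiewicz⇒isMu {k = k} ((M , noSub , onesM≡k) , maximal) =
  (support M , support-mutualVisibility (¬HasAllOnesSub⇒rectangleFree noSub) ,
   trans (length-support M) onesM≡k) ,
  λ X mvX → subst (_≤ k) (sym (length≡ones-indicator (proj₁ mvX)))
    (maximal (indicator X) (rectangleFree⇒¬HasAllOnesSub (mutualVisibility⇒indicator-rectangleFree mvX)))

-- Existence of z(m, n; 2, 2) by exhaustive search

functions : ∀ {A : Set} → List A → (k : ℕ) → List (Fin k → A)
functions xs zero    = (λ ()) ∷ []
functions xs (suc k) = concat (map (λ x → map (x Vector.∷_) (functions xs k)) xs)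

functions-complete : ∀ {A : Set} (xs : List A) (R : A → A → Set) →
  (∀ a → Σ A λ x → x ∈ xs × R a x) →
  ∀ k (f : Fin k → A) → Σ (Fin k → A) λ g → g ∈ functions xs k × (∀ i → R (f i) (g i))
functions-complete xs R covered zero    f = (λ ()) , here refl , λ ()
functions-complete xs R covered (suc k) f
  with covered (f zero) | functions-complete xs R covered k (f ∘ suc)
... | x , x∈xs , Rfx | g , g∈ , Rfg =
  x Vector.∷ g ,
  ∈-concat⁺′ (∈-map⁺ (x Vector.∷_) g∈) (∈-map⁺ (λ x → map (x Vector.∷_) (functions xs k)) x∈xs) ,
  λ { zero → Rfx ; (suc i) → Rfg i }

matrices : ∀ m n → List (Matrix m n)
matrices m n = functions (functions (true ∷ false ∷ []) n) m

-- Without function extensionality a matrix is only listed up to pointwise equality.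
matrices-complete : ∀ {m n} (M : Matrix m n) →
  Σ (Matrix m n) λ M' → M' ∈ matrices m n × (∀ i j → M i j ≡ M' i j)
matrices-complete {m} {n} M = functions-complete _ (λ f g → ∀ j → f j ≡ g j) row-listed m M
  where
  bool-listed : ∀ b → Σ Bool λ b' → b' ∈ true ∷ false ∷ [] × b ≡ b'
  bool-listed true  = true , here refl , refl
  bool-listed false = false , there (here refl) , refl
  row-listed : ∀ (f : Fin n → Bool) → Σ (Fin n → Bool) λ g → g ∈ functions _ n × (∀ j → f j ≡ g j)
  row-listed = functions-complete _ _≡_ bool-listed n

maximum-of-dominating-list : ∀ {A : Set} {P : A → Set} (P? : Decidable P) (f : A → ℕ) xs {a₀} → P a₀ →
  (∀ a → P a → Σ A λ b → b ∈ xs × P b × f a ≤ f b) →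
  Σ A λ a → P a × (∀ b → P b → f b ≤ f a)
maximum-of-dominating-list {P = P} P? f xs {a₀} Pa₀ dominated =
  argmax f a₀ (filter P? xs) , argmax-all f Pa₀ (all-filter P? xs) , bound
  where
  bound : ∀ b → P b → f b ≤ f (argmax f a₀ (filter P? xs))
  bound b Pb with dominated b Pb
  ... | b' , b'∈xs , Pb' , fb≤fb' =
    ≤-trans fb≤fb' (lookup (f[xs]≤f[argmax] {f = f} a₀ (filter P? xs)) (∈-filter⁺ P? b'∈xs Pb'))

matrices-dominate : ∀ {m n} (M : Matrix m n) → RectangleFree M →
  Σ (Matrix m n) λ M' → M' ∈ matrices m n × RectangleFree M' × ones M ≤ ones M'
matrices-dominate M rf with matrices-complete M
... | M' , M'∈ , M≗M' = M' , M'∈ , rectangleFree-cong M≗M' rf , ≤-reflexive (ones-cong M≗M')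

zarankiewicz-2-2 : ∀ m n → Σ ℕ (IsZarankiewicz m n 2 2)
zarankiewicz-2-2 m n
  with maximum-of-dominating-list rectangleFree? ones (matrices m n) {λ _ _ → false}
         (λ _ _ _ _ _ _ ()) matrices-dominate
... | M , rf , maximal =
  ones M , (M , rectangleFree⇒¬HasAllOnesSub rf , refl) ,
  λ M' noSub → maximal M' (¬HasAllOnesSub⇒rectangleFree noSub)

-- The equality holds for all m and n.
corollary3p7 : (m n : ℕ) → 2 ≤ m → 2 ≤ n →
    Σ ℕ λ k → IsMu (K m □ K n) k × IsZarankiewicz m n 2 2 k
corollary3p7 m n _ _ with zarankiewicz-2-2 m n
... | k , isZ = k , isZarankiewicz⇒isMu isZ , isZ
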